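{- Let $G$ be a simple connected graph and let $\mathcal{A}(G)$ be the auxiliary graph defined in the context. Then $G$ is chordal if and only if $\mathcal{A}(G)$ is chordal.
   Context: A graph is chordal if it contains no induced cycle (hole) of length at least $4$. For a graph $G=(V,E)$, let $\mathcal{T}(G)$ be the set of vertex sets of triangles of $G$ (3-element sets inducing a complete graph), and $\mathcal{I}(G)$ the set of vertex subsets of $G$ with at least two elements that induce a path (a set $\{v_1,\dots,v_p\}$ whose induced edge set is exactly $\{v_iv_{i+1}: 1\le i\le p-1\}$). The graph $\mathcal{A}(G)$ has vertex set $V\cup\mathcal{T}(G)\cup\mathcal{I}(G)$, where each $v\in V$ is identified with the singleton $\{v\}$; two distinct vertices $L,L'$ of $\mathcal{A}(G)$ are adjacent if and only if $G[L\cup L']$ is connected. -}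

module Defs where

open import Data.Nat using (ℕ; zero; suc; _≤_)
open import Data.Bool using (Bool; true; false)
open import Data.Fin using (Fin; toℕ)
open import Data.Fin.Subset using (Subset; _∈_; _∪_; ⁅_⁆; ∣_∣)
open import Data.Product using (Σ; ∃; _×_; _,_)
open import Data.Sum using (_⊎_)
open import Data.Unit using (⊤)
open import Function.Bundles using (_⇔_)
open import Relation.Nullary using (¬_)
open import Relation.Binary.PropositionalEquality using (_≡_; _≢_)

record Graph (n : ℕ) : Set where
  field
    adj    : Fin n → Fin n → Bool
    sym    : ∀ u v → adj u v ≡ adj v u
    irrefl : ∀ v → adj v v ≡ false
open Graph public

Adj : ∀ {n} → Graph n → Fin n → Fin n → Set
Adj G u v = adj G u v ≡ true

data Reach {n : ℕ} (G : Graph n) (S : Subset n) : Fin n → Fin n → Set where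
  here : ∀ {u} → u ∈ S → Reach G S u u
  step : ∀ {u w v} → u ∈ S → Adj G u w → Reach G S w v → Reach G S u v

InducedConnected : ∀ {n} → Graph n → Subset n → Set
InducedConnected G S = ∀ u v → u ∈ S → v ∈ S → Reach G S u v

Connected : ∀ {n} → Graph n → Set
Connected {n} G = ∀ (u v : Fin n) → Reach G (Data.Fin.Subset.⊤) u v

CycNeighbor : (k : ℕ) → Fin k → Fin k → Set
CycNeighbor k i j =
  (toℕ j ≡ suc (toℕ i)) ⊎ (toℕ i ≡ suc (toℕ j)) ⊎
  ((toℕ i ≡ 0 × suc (toℕ j) ≡ k) ⊎ (toℕ j ≡ 0 × suc (toℕ i) ≡ k))

PathNeighbor : (k : ℕ) → Fin k → Fin k → Set
PathNeighbor k i j = (toℕ j ≡ suc (toℕ i)) ⊎ (toℕ i ≡ suc (toℕ j))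

HasHole : {V : Set} → (V → Set) → (V → V → Set) → Set
HasHole {V} Vert E =
  Σ ℕ λ k → Σ (Fin k → V) λ c →
    (4 ≤ k) × (∀ i → Vert (c i)) × (∀ i j → c i ≡ c j → i ≡ j) ×
    (∀ i j → E (c i) (c j) ⇔ CycNeighbor k i j)

ChordalOn : {V : Set} → (V → Set) → (V → V → Set) → Set
ChordalOn Vert E = ¬ HasHole Vert E

Chordal : ∀ {n} → Graph n → Set
Chordal {n} G = ChordalOn {Fin n} (λ _ → ⊤) (Adj G)

IsSingleton : ∀ {n} → Subset n → Set
IsSingleton S = ∃ λ v → S ≡ ⁅ v ⁆

IsTriangle : ∀ {n} → Graph n → Subset n → Set
IsTriangle G S = (∣ S ∣ ≡ 3) × (∀ u v → u ∈ S → v ∈ S → u ≢ v → Adj G u v)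

IsInducedPath : ∀ {n} → Graph n → Subset n → Set
IsInducedPath {n} G S =
  Σ ℕ λ p → Σ (Fin p → Fin n) λ f →
    (2 ≤ p) × (∀ i j → f i ≡ f j → i ≡ j) ×
    (∀ v → v ∈ S ⇔ (∃ λ i → f i ≡ v)) ×
    (∀ i j → Adj G (f i) (f j) ⇔ PathNeighbor p i j)

-- L ∈ V ∪ 𝒯(G) ∪ ℐ(G)  (singletons identified with vertices)
IsAVertex : ∀ {n} → Graph n → Subset n → Set
IsAVertex G L = IsSingleton L ⊎ IsTriangle G L ⊎ IsInducedPath G L

AAdj : ∀ {n} → Graph n → Subset n → Subset n → Set
AAdj G L L' = (L ≢ L') × InducedConnected G (L ∪ L')

AChordal : ∀ {n} → Graph n → Set
AChordal {n} G = ChordalOn {Subset n} (IsAVertex G) (AAdj G)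

-- A hole of G is a hole of 𝒜(G) on singletons.  Conversely, the vertices of a
-- hole of 𝒜(G) are nonempty connected sets, each touching (sharing or joining
-- a vertex with) exactly its two cyclic neighbours, and a walk covering each
-- set has the same touching pattern.  While one of these walks has at least two
-- vertices, split off its first vertex: the head alone, the tail alone, or both
-- in sequence (lengthening the cycle) can take the walk's place, and the total
-- number of surplus walk vertices drops.  When every walk is a single vertex,
-- the vertices form a hole of G.

module Submission where

open import Data.Bool using (true)
import Data.Bool.Properties as Bool
open import Data.Empty using (⊥; ⊥-elim)
open import Data.Fin as Fin using (Fin; toℕ)
import Data.Fin.Properties as Fin
open import Data.Fin.Subset using (Subset; _∈_; _∪_; ⁅_⁆; ∣_∣; Nonempty)
open import Data.Fin.Subset.Properties
  using (_∈?_; x∈p∪q⁻; x∈p∪q⁺; x∈⁅x⁆; x∈⁅y⁆⇒x≡y; nonempty?; Empty-unique; ∣⊥∣≡0)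
open import Data.List using (List; []; _∷_; length; allFin)
open import Data.List.Membership.Propositional using (find; lose) renaming (_∈_ to _∈ₗ_)
open import Data.List.Membership.Propositional.Properties using (∈-allFin)
open import Data.List.Relation.Unary.Any as Any using (Any; here; there)
open import Data.List.Relation.Unary.Any.Properties using (swap)
open import Data.List.Relation.Unary.Linked as Linked using (Linked; [-]; _∷_)
open import Data.Nat using (ℕ; zero; suc; _+_; _≤_; _<_; z≤n; s≤s)
open import Data.Nat.Induction using (<-wellFounded)
open import Data.Nat.Properties using (suc-injective; 0≢1+n; 1+n≢n; 1+n≰n; +-comm; +-assoc; m≤n+m; ≤-refl)
open import Data.Product as Product using (Σ; ∃; ∃₂; _×_; _,_; proj₁; proj₂)
open import Data.Product.Function.NonDependent.Propositional using (_×-⇔_)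
open import Data.Sum as Sum using (_⊎_; inj₁; inj₂; [_,_])
open import Data.Unit using (⊤; tt)
open import Data.Vec as Vec using (Vec; []; _∷_; _∷ʳ_; lookup; tabulate; initLast; map; sum)
open import Data.Vec.Properties using (lookup∘tabulate)
open import Data.Vec.Relation.Unary.All as All using (All; []; _∷_)
open import Data.Vec.Relation.Unary.All.Properties using (lookup⁺; lookup⁻)
open import Data.Vec.Relation.Unary.Unique.Propositional as Unique using (Unique; []; _∷_)
open import Data.Vec.Relation.Unary.Unique.Propositional.Properties using (lookup-injective)
open import Function using (_∘_; id; const)
open import Function.Bundles using (_⇔_; mk⇔; Equivalence)
open import Function.Construct.Composition using (_⇔-∘_)
open import Function.Construct.Symmetry using (⇔-sym)
open import Induction.WellFounded using (Acc; acc)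
open import Relation.Nullary using (¬_; Dec)
open import Relation.Nullary.Decidable using (yes; no; _⊎-dec_)
open import Relation.Binary.PropositionalEquality hiding ([_])

open import Defs hiding (sym)

open Equivalence using (to; from)

PathNeighbor-sym : ∀ {k} {i j : Fin k} → PathNeighbor k i j → PathNeighbor k j i
PathNeighbor-sym = Sum.swap

CycNeighbor-sym : ∀ {k} {i j : Fin k} → CycNeighbor k i j → CycNeighbor k j i
CycNeighbor-sym (inj₁ e)                = inj₂ (inj₁ e)
CycNeighbor-sym (inj₂ (inj₁ e))         = inj₁ e
CycNeighbor-sym (inj₂ (inj₂ (inj₁ e))) = inj₂ (inj₂ (inj₂ e))
CycNeighbor-sym (inj₂ (inj₂ (inj₂ e))) = inj₂ (inj₂ (inj₁ e))

CycNeighbor-irrefl : ∀ {k} {i : Fin k} → 2 ≤ k → ¬ CycNeighbor k i i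
CycNeighbor-irrefl _ (inj₁ e)         = 1+n≢n (sym e)
CycNeighbor-irrefl _ (inj₂ (inj₁ e))  = 1+n≢n (sym e)
CycNeighbor-irrefl 2≤k (inj₂ (inj₂ (inj₁ (i≡0 , 1+i≡k)))) =
  1+n≰n (subst (2 ≤_) (trans (sym 1+i≡k) (cong suc i≡0)) 2≤k)
CycNeighbor-irrefl 2≤k (inj₂ (inj₂ (inj₂ e))) = CycNeighbor-irrefl 2≤k (inj₂ (inj₂ (inj₁ e)))

PathNeighbor-suc : ∀ {m} {i j : Fin m} → PathNeighbor (suc m) (Fin.suc i) (Fin.suc j) ⇔ PathNeighbor m i j
PathNeighbor-suc = mk⇔ (Sum.map suc-injective suc-injective) (Sum.map (cong suc) (cong suc))

CycNeighbor-suc : ∀ {m} {i j : Fin m} → CycNeighbor (suc m) (Fin.suc i) (Fin.suc j) ⇔ PathNeighbor m i j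
CycNeighbor-suc = mk⇔
  (Sum.map suc-injective λ { (inj₁ e) → suc-injective e ; (inj₂ (inj₁ (() , _))) ; (inj₂ (inj₂ (() , _))) })
  (Sum.map (cong suc) (inj₁ ∘ cong suc))

CycNeighbor-wrap : ∀ {n} {j : Fin (suc n)} → CycNeighbor (3 + n) Fin.zero (Fin.suc (Fin.suc j)) ⇔ (toℕ j ≡ n)
CycNeighbor-wrap = mk⇔
  (λ { (inj₁ ()) ; (inj₂ (inj₁ ())) ; (inj₂ (inj₂ (inj₂ (() , _))))
     ; (inj₂ (inj₂ (inj₁ (_ , e)))) → suc-injective (suc-injective (suc-injective e)) })
  (λ e → inj₂ (inj₂ (inj₁ (refl , cong (suc ∘ suc ∘ suc) e))))

All-∷ʳ⁺ : ∀ {A : Set} {P : A → Set} {n} {xs : Vec A n} {x} → All P xs → P x → All P (xs ∷ʳ x)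
All-∷ʳ⁺ []         px = px ∷ []
All-∷ʳ⁺ (py ∷ pys) px = py ∷ All-∷ʳ⁺ pys px

All-∷ʳ⁻ : ∀ {A : Set} {P : A → Set} {n} (xs : Vec A n) {x} → All P (xs ∷ʳ x) → All P xs × P x
All-∷ʳ⁻ []       (px ∷ [])  = [] , px
All-∷ʳ⁻ (_ ∷ xs) (py ∷ pys) = Product.map₁ (py ∷_) (All-∷ʳ⁻ xs pys)

sum-map-∷ʳ : ∀ {A : Set} {m} (f : A → ℕ) (xs : Vec A m) {x} → sum (map f (xs ∷ʳ x)) ≡ sum (map f xs) + f x
sum-map-∷ʳ f []       {x} = +-comm (f x) 0
sum-map-∷ʳ f (y ∷ xs) {x} = trans (cong (f y +_) (sum-map-∷ʳ f xs)) (sym (+-assoc (f y) _ (f x)))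

-- Induced paths and cycles for a symmetric relation

module Induced {X : Set} (T : X → X → Set) (T-sym : ∀ {a b} → T a b → T b a) where

  -- Only distinct positions are constrained, as T may be reflexive.
  Shaped : ∀ {k} → (Fin k → Fin k → Set) → (Fin k → X) → Set
  Shaped N c = ∀ i j → i ≢ j → T (c i) (c j) ⇔ N i j

  Shaped-resp-≗ : ∀ {k} {N : Fin k → Fin k → Set} {c c′ : Fin k → X} →
                  c ≗ c′ → Shaped N c → Shaped N c′
  Shaped-resp-≗ c≗c′ sh i j i≢j = subst₂ (λ a b → T a b ⇔ _) (c≗c′ i) (c≗c′ j) (sh i j i≢j)

  LinksExactly : ∀ {k} → (Fin k → Set) → X → (Fin k → X) → Set
  LinksExactly Z x c = ∀ j → T x (c j) ⇔ Z j

  Shaped-∷ : ∀ {m} {N : Fin (suc m) → Fin (suc m) → Set} {N′ : Fin m → Fin m → Set}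
               {c : Fin (suc m) → X} →
             (∀ {i j} → N i j → N j i) → (∀ {i j} → N (Fin.suc i) (Fin.suc j) ⇔ N′ i j) →
             Shaped N c ⇔ (LinksExactly (N Fin.zero ∘ Fin.suc) (c Fin.zero) (c ∘ Fin.suc) × Shaped N′ (c ∘ Fin.suc))
  Shaped-∷ {N = N} {N′} {c} N-sym N-suc = mk⇔ decompose compose
    where
    Parts : Set
    Parts = LinksExactly (N Fin.zero ∘ Fin.suc) (c Fin.zero) (c ∘ Fin.suc) × Shaped N′ (c ∘ Fin.suc)
    decompose : Shaped N c → Parts
    decompose sh = (λ j → sh Fin.zero (Fin.suc j) (λ ()))
                 , (λ i j i≢j → N-suc ⇔-∘ sh (Fin.suc i) (Fin.suc j) (i≢j ∘ Fin.suc-injective))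
    compose : Parts → Shaped N c
    compose (row , sh) Fin.zero    Fin.zero    i≢j = ⊥-elim (i≢j refl)
    compose (row , sh) Fin.zero    (Fin.suc j) _   = row j
    compose (row , sh) (Fin.suc i) Fin.zero    _   =
      mk⇔ (N-sym ∘ to (row i) ∘ T-sym) (T-sym ∘ from (row i) ∘ N-sym)
    compose (row , sh) (Fin.suc i) (Fin.suc j) i≢j = ⇔-sym N-suc ⇔-∘ sh i j (i≢j ∘ cong Fin.suc)

  LinksOnlyHead : ∀ {m} → X → Vec X m → Set
  LinksOnlyHead x []       = ⊤
  LinksOnlyHead x (y ∷ ys) = T x y × All (λ z → ¬ T x z) ys

  IsPath : ∀ {m} → Vec X m → Set
  IsPath []       = ⊤
  IsPath (x ∷ xs) = LinksOnlyHead x xs × IsPath xs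

  linksOnlyHead⇔ : ∀ {m x} {ys : Vec X m} →
                   LinksOnlyHead x ys ⇔ LinksExactly (PathNeighbor (suc m) Fin.zero ∘ Fin.suc) x (lookup ys)
  linksOnlyHead⇔ {ys = []}     = mk⇔ (λ _ ()) (const tt)
  linksOnlyHead⇔ {x = x} {ys = y ∷ ys} = mk⇔ row unrow
    where
    row : LinksOnlyHead x (y ∷ ys) → LinksExactly (PathNeighbor _ Fin.zero ∘ Fin.suc) x (lookup (y ∷ ys))
    row (xy , _)   Fin.zero    = mk⇔ (const (inj₁ refl)) (const xy)
    row (_ , ¬xys) (Fin.suc j) = mk⇔ (⊥-elim ∘ lookup⁺ ¬xys j) (λ { (inj₁ ()) ; (inj₂ ()) })
    unrow : LinksExactly (PathNeighbor _ Fin.zero ∘ Fin.suc) x (lookup (y ∷ ys)) → LinksOnlyHead x (y ∷ ys)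
    unrow r = from (r Fin.zero) (inj₁ refl)
            , lookup⁻ (λ j → (λ { (inj₁ ()) ; (inj₂ ()) }) ∘ to (r (Fin.suc j)))

  isPath⇔ : ∀ {m} {xs : Vec X m} → IsPath xs ⇔ Shaped (PathNeighbor m) (lookup xs)
  isPath⇔ {xs = []}     = mk⇔ (λ _ ()) (const tt)
  isPath⇔ {xs = x ∷ xs} =
    ⇔-sym (Shaped-∷ PathNeighbor-sym PathNeighbor-suc) ⇔-∘ (linksOnlyHead⇔ ×-⇔ isPath⇔)

  linksOnlyLast⇔ : ∀ {n x q} {mid : Vec X n} →
                   (T x q × All (λ y → ¬ T x y) mid) ⇔ LinksExactly (λ j → toℕ j ≡ n) x (lookup (mid ∷ʳ q))
  linksOnlyLast⇔ {mid = []} = mk⇔ (λ { (xq , []) Fin.zero → mk⇔ (const refl) (const xq) })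
                                  (λ r → from (r Fin.zero) refl , [])
  linksOnlyLast⇔ {x = x} {q} {mid = y ∷ mid} = mk⇔ row unrow
    where
    Last : Fin (2 + _) → Set
    Last j = toℕ j ≡ suc _
    row : T x q × All (λ z → ¬ T x z) (y ∷ mid) → LinksExactly Last x (lookup (y ∷ (mid ∷ʳ q)))
    row (_  , ¬xy ∷ _)    Fin.zero    = mk⇔ (⊥-elim ∘ ¬xy) (λ ())
    row (xq , _ ∷ ¬xmid) (Fin.suc j) = mk⇔ (cong suc ∘ to rest) (from rest ∘ suc-injective)
      where rest : T x (lookup (mid ∷ʳ q) j) ⇔ toℕ j ≡ _
            rest = to linksOnlyLast⇔ (xq , ¬xmid) j
    unrow : LinksExactly Last x (lookup (y ∷ (mid ∷ʳ q))) → T x q × All (λ z → ¬ T x z) (y ∷ mid)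
    unrow r = Product.map₂ ((0≢1+n ∘ to (r Fin.zero)) ∷_)
                (from linksOnlyLast⇔ λ j →
                   mk⇔ (suc-injective ∘ to (r (Fin.suc j))) (from (r (Fin.suc j)) ∘ cong suc))

  record IsCycle {n} (x p : X) (mid : Vec X n) (q : X) : Set where
    field
      path      : IsPath (p ∷ (mid ∷ʳ q))
      linkFirst : T x p
      linkLast  : T x q
      noChord   : All (λ y → ¬ T x y) mid
  open IsCycle

  isCycle⇔ : ∀ {n x p q} {mid : Vec X n} →
             IsCycle x p mid q ⇔ Shaped (CycNeighbor (3 + n)) (lookup (x ∷ p ∷ (mid ∷ʳ q)))
  isCycle⇔ {n} {x} {p} {q} {mid} =
    ⇔-sym (Shaped-∷ CycNeighbor-sym CycNeighbor-suc) ⇔-∘ ((ends⇔ ×-⇔ isPath⇔) ⇔-∘ fields)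
    where
    fields : IsCycle x p mid q ⇔ ((T x p × T x q × All (λ y → ¬ T x y) mid) × IsPath (p ∷ (mid ∷ʳ q)))
    fields = mk⇔ (λ c → (linkFirst c , linkLast c , noChord c) , path c)
                 λ { ((xp , xq , ¬xmid) , pa) →
                     record { path = pa ; linkFirst = xp ; linkLast = xq ; noChord = ¬xmid } }
    ends⇔ : (T x p × T x q × All (λ y → ¬ T x y) mid) ⇔
            LinksExactly (CycNeighbor (3 + n) Fin.zero ∘ Fin.suc) x (lookup (p ∷ (mid ∷ʳ q)))
    ends⇔ = mk⇔ (λ { (xp , _)    Fin.zero    → mk⇔ (const (inj₁ refl)) (const xp)
                   ; (_ , last) (Fin.suc j) → ⇔-sym CycNeighbor-wrap ⇔-∘ to linksOnlyLast⇔ last j })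
                λ r → from (r Fin.zero) (inj₁ refl)
                    , from linksOnlyLast⇔ (λ j → CycNeighbor-wrap ⇔-∘ r (Fin.suc j))

  linksOnlyHead-∷ʳ : ∀ {m y x} (zs : Vec X (suc m)) → LinksOnlyHead y zs → ¬ T y x →
                     LinksOnlyHead y (zs ∷ʳ x)
  linksOnlyHead-∷ʳ (_ ∷ _) (yz , ¬yzs) ¬yx = yz , All-∷ʳ⁺ ¬yzs ¬yx

  path-∷ʳ : ∀ {m q x} (ys : Vec X m) → IsPath (ys ∷ʳ q) → T q x → All (λ y → ¬ T y x) ys →
            IsPath ((ys ∷ʳ q) ∷ʳ x)
  path-∷ʳ []       _          qx []          = (qx , []) , tt , tt
  path-∷ʳ (_ ∷ ys) (yl , yp) qx (¬yx ∷ ¬ys) = linksOnlyHead-∷ʳ (ys ∷ʳ _) yl ¬yx , path-∷ʳ ys yp qx ¬ys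

  rotate : ∀ {n x p q} {mid : Vec X (suc n)} → IsCycle x p mid q → IsCycle p (Vec.head mid) (Vec.tail mid ∷ʳ q) x
  rotate {mid = m ∷ mid} c = record
    { path      = path-∷ʳ (m ∷ mid) (proj₂ (path c)) (T-sym (linkLast c)) (All.map (_∘ T-sym) (noChord c))
    ; linkFirst = proj₁ (proj₁ (path c))
    ; linkLast  = T-sym (linkFirst c)
    ; noChord   = proj₂ (proj₁ (path c))
    }

  _⊑_ : X → X → Set
  a ⊑ x = ∀ {y} → T a y → T x y

  shrink : ∀ {n x p q a} {mid : Vec X n} → IsCycle x p mid q → a ⊑ x → T a p → T a q → IsCycle a p mid q
  shrink c a⊑x ap aq = record
    { path = path c ; linkFirst = ap ; linkLast = aq ; noChord = All.map (_∘ a⊑x) (noChord c) }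

  split : ∀ {n x p q a b} {mid : Vec X n} → IsCycle x p mid q → a ⊑ x → b ⊑ x →
          T a b → T a q → ¬ T a p → T b p → ¬ T b q → IsCycle a b (p ∷ mid) q
  split c a⊑x b⊑x ab aq ¬ap bp ¬bq = record
    { path      = (bp , All-∷ʳ⁺ (All.map (_∘ b⊑x) (noChord c)) ¬bq) , path c
    ; linkFirst = ab
    ; linkLast  = aq
    ; noChord   = ¬ap ∷ All.map (_∘ a⊑x) (noChord c)
    }

  separate : ∀ {n x p q a b} {mid : Vec X n} → (∀ a b → Dec (T a b)) → IsCycle x p mid q →
             a ⊑ x → b ⊑ x → T a b → (∀ {y} → T x y → T a y ⊎ T b y) →
             IsCycle a p mid q ⊎ IsCycle b p mid q ⊎ IsCycle a b (p ∷ mid) q ⊎ IsCycle b a (p ∷ mid) q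
  separate {p = p} {q} {a} {b} T? c a⊑x b⊑x ab x⊑a∪b with T? a p | T? a q | T? b p | T? b q
  ... | yes ap | yes aq | _      | _      = inj₁ (shrink c a⊑x ap aq)
  ... | _      | _      | yes bp | yes bq = inj₂ (inj₁ (shrink c b⊑x bp bq))
  ... | no ¬ap | _      | no ¬bp | _      = ⊥-elim ([ ¬ap , ¬bp ] (x⊑a∪b (linkFirst c)))
  ... | _      | no ¬aq | _      | no ¬bq = ⊥-elim ([ ¬aq , ¬bq ] (x⊑a∪b (linkLast c)))
  ... | no ¬ap | yes aq | yes bp | no ¬bq = inj₂ (inj₂ (inj₁ (split c a⊑x b⊑x ab aq ¬ap bp ¬bq)))
  ... | yes ap | no ¬aq | no ¬bp | yes bq = inj₂ (inj₂ (inj₂ (split c b⊑x a⊑x (T-sym ab) bq ¬bp ap ¬aq)))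

  record Cycle : Set where
    constructor cycle
    field
      {size}  : ℕ
      x p     : X
      mid     : Vec X (suc size)
      q       : X
      isCycle : IsCycle x p mid q

    elements : Vec X (4 + size)
    elements = x ∷ p ∷ (mid ∷ʳ q)

    shaped : Shaped (CycNeighbor (4 + size)) (lookup elements)
    shaped = to isCycle⇔ isCycle

  cycleOf : ∀ {k} {c : Fin k → X} → 4 ≤ k → Shaped (CycNeighbor k) c → Cycle
  cycleOf {c = c} (s≤s (s≤s (s≤s (s≤s _)))) sh with initLast (tabulate (c ∘ Fin.suc ∘ Fin.suc))
  ... | mid , q , tabulate≡ = cycle x p mid q (from isCycle⇔ (Shaped-resp-≗ c≗ sh))
    where
    x p : X
    x = c Fin.zero
    p = c (Fin.suc Fin.zero)
    c≗ : c ≗ lookup (x ∷ p ∷ (mid ∷ʳ q))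
    c≗ i = trans (sym (lookup∘tabulate c i)) (cong (λ v → lookup (x ∷ p ∷ v) i) tabulate≡)

  rotateCycle : Cycle → Cycle
  rotateCycle (cycle x p mid q c) = cycle p (Vec.head mid) (Vec.tail mid ∷ʳ q) x (rotate c)

  elements-rotateCycle : ∀ C → Cycle.elements (rotateCycle C) ≡
                               Vec.tail (Cycle.elements C) ∷ʳ Vec.head (Cycle.elements C)
  elements-rotateCycle (cycle _ _ (_ ∷ _) _ _) = refl

-- Connected vertex sets and walks

module _ {n : ℕ} (G : Graph n) where

  V : Set
  V = Fin n

  Adj-sym : ∀ {u v} → Adj G u v → Adj G v u
  Adj-sym {u} {v} = trans (Graph.sym G v u)

  Adj-irrefl : ∀ {v} → ¬ Adj G v v
  Adj-irrefl {v} a with () ← trans (sym (irrefl G v)) a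

  Close : V → V → Set
  Close u v = u ≡ v ⊎ Adj G u v

  Close-sym : ∀ {u v} → Close u v → Close v u
  Close-sym = Sum.map sym Adj-sym

  Close? : ∀ u v → Dec (Close u v)
  Close? u v = (u Fin.≟ v) ⊎-dec (adj G u v Bool.≟ true)

  Reach-start : ∀ {S u v} → Reach G S u v → u ∈ S
  Reach-start (here u∈S)     = u∈S
  Reach-start (step u∈S _ _) = u∈S

  Reach-end : ∀ {S u v} → Reach G S u v → v ∈ S
  Reach-end (here v∈S)   = v∈S
  Reach-end (step _ _ r) = Reach-end r

  Reach-trans : ∀ {S u v w} → Reach G S u v → Reach G S v w → Reach G S u w
  Reach-trans (here _)       r′ = r′
  Reach-trans (step u∈S a r) r′ = step u∈S a (Reach-trans r r′)

  Reach-sym : ∀ {S u v} → Reach G S u v → Reach G S v u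
  Reach-sym (here u∈S)     = here u∈S
  Reach-sym (step u∈S a r) = Reach-trans (Reach-sym r) (step (Reach-start r) (Adj-sym a) (here u∈S))

  Reach-mono : ∀ {S S′ u v} → (∀ {w} → w ∈ S → w ∈ S′) → Reach G S u v → Reach G S′ u v
  Reach-mono S⊆S′ (here u∈S)     = here (S⊆S′ u∈S)
  Reach-mono S⊆S′ (step u∈S a r) = step (S⊆S′ u∈S) a (Reach-mono S⊆S′ r)

  Reach-via : ∀ {S s u v t} → Reach G S s u → Close u v → Reach G S v t → Reach G S s t
  Reach-via r (inj₁ refl) r′ = Reach-trans r r′
  Reach-via r (inj₂ a)    r′ = Reach-trans r (step (Reach-end r) a r′)

  Touching : Subset n → Subset n → Set
  Touching L L′ = ∃₂ λ u v → u ∈ L × v ∈ L′ × Close u v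

  Reach⇒Touching : ∀ {L L′ u v} → Reach G (L ∪ L′) u v → u ∈ L → v ∈ L′ → Touching L L′
  Reach⇒Touching {u = u} (here _) u∈L v∈L′ = u , u , u∈L , v∈L′ , inj₁ refl
  Reach⇒Touching {L} {L′} {u} (step _ a r) u∈L v∈L′ with x∈p∪q⁻ L L′ (Reach-start r)
  ... | inj₁ w∈L  = Reach⇒Touching r w∈L v∈L′
  ... | inj₂ w∈L′ = u , _ , u∈L , w∈L′ , inj₂ a

  Reach-∪ˡ : ∀ {L L′ u v} → Reach G L u v → Reach G (L ∪ L′) u v
  Reach-∪ˡ = Reach-mono (x∈p∪q⁺ ∘ inj₁)

  Reach-∪ʳ : ∀ {L L′ u v} → Reach G L′ u v → Reach G (L ∪ L′) u v
  Reach-∪ʳ = Reach-mono (x∈p∪q⁺ ∘ inj₂)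

  ∪-connected : ∀ {L L′} → InducedConnected G L → InducedConnected G L′ → Touching L L′ →
                InducedConnected G (L ∪ L′)
  ∪-connected {L} {L′} conn conn′ (u , v , u∈L , v∈L′ , uv) s t s∈ t∈
    with x∈p∪q⁻ L L′ s∈ | x∈p∪q⁻ L L′ t∈
  ... | inj₁ s∈L  | inj₁ t∈L  = Reach-∪ˡ (conn s t s∈L t∈L)
  ... | inj₂ s∈L′ | inj₂ t∈L′ = Reach-∪ʳ (conn′ s t s∈L′ t∈L′)
  ... | inj₁ s∈L  | inj₂ t∈L′ =
    Reach-via (Reach-∪ˡ (conn s u s∈L u∈L)) uv (Reach-∪ʳ (conn′ v t v∈L′ t∈L′))
  ... | inj₂ s∈L′ | inj₁ t∈L  =
    Reach-sym (Reach-via (Reach-∪ˡ (conn t u t∈L u∈L)) uv (Reach-∪ʳ (conn′ v s v∈L′ s∈L′)))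

  ∪-connected⇔Touching : ∀ {L L′} → InducedConnected G L → InducedConnected G L′ →
                         Nonempty L → Nonempty L′ → InducedConnected G (L ∪ L′) ⇔ Touching L L′
  ∪-connected⇔Touching conn conn′ (u , u∈L) (v , v∈L′) =
    mk⇔ (λ conn∪ → Reach⇒Touching (conn∪ u v (x∈p∪q⁺ (inj₁ u∈L)) (x∈p∪q⁺ (inj₂ v∈L′))) u∈L v∈L′)
        (∪-connected conn conn′)

  reachAlong : ∀ {m S} (f : Fin (suc m) → V) → (∀ {i j} → PathNeighbor (suc m) i j → Adj G (f i) (f j)) →
               (∀ i → f i ∈ S) → ∀ i → Reach G S (f Fin.zero) (f i)
  reachAlong f adjacent inS Fin.zero = here (inS Fin.zero)
  reachAlong {suc m} f adjacent inS (Fin.suc i) =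
    step (inS Fin.zero) (adjacent (inj₁ refl))
         (reachAlong (f ∘ Fin.suc) (adjacent ∘ from PathNeighbor-suc) (inS ∘ Fin.suc) i)

  inducedPath-connected : ∀ {L} → IsInducedPath G L → InducedConnected G L
  inducedPath-connected (zero , _ , () , _)
  inducedPath-connected {L} (suc m , f , _ , _ , mem , adjP) s t s∈L t∈L =
    Reach-trans (Reach-sym (fromStart s s∈L)) (fromStart t t∈L)
    where
    fromStart : ∀ v → v ∈ L → Reach G L (f Fin.zero) v
    fromStart v v∈L with to (mem v) v∈L
    ... | i , refl = reachAlong f (from (adjP _ _)) (λ i → from (mem (f i)) (i , refl)) i

  triangle-connected : ∀ {L} → IsTriangle G L → InducedConnected G L
  triangle-connected (_ , adjT) s t s∈L t∈L with s Fin.≟ t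
  ... | yes refl = here s∈L
  ... | no s≢t   = step s∈L (adjT s t s∈L t∈L s≢t) (here t∈L)

  triangle-nonempty : ∀ {L} → IsTriangle G L → Nonempty L
  triangle-nonempty {L} (∣L∣≡3 , _) with nonempty? L
  ... | yes ne  = ne
  ... | no ¬ne with () ← trans (sym ∣L∣≡3) (trans (cong ∣_∣ (Empty-unique ¬ne)) (∣⊥∣≡0 n))

  AVertex-connected : ∀ {L} → IsAVertex G L → InducedConnected G L
  AVertex-connected (inj₁ (v , refl)) s t s∈ t∈ with x∈⁅y⁆⇒x≡y v s∈ | x∈⁅y⁆⇒x≡y v t∈
  ... | refl | refl = here s∈
  AVertex-connected (inj₂ (inj₁ triangle)) = triangle-connected triangle
  AVertex-connected (inj₂ (inj₂ path))     = inducedPath-connected path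

  AVertex-nonempty : ∀ {L} → IsAVertex G L → Nonempty L
  AVertex-nonempty (inj₁ (v , refl))                         = v , x∈⁅x⁆ v
  AVertex-nonempty (inj₂ (inj₁ triangle))                    = triangle-nonempty triangle
  AVertex-nonempty (inj₂ (inj₂ (zero , _ , () , _)))
  AVertex-nonempty (inj₂ (inj₂ (suc _ , f , _ , _ , mem , _))) = f Fin.zero , from (mem (f Fin.zero)) (Fin.zero , refl)

  AAdj⇔Touching : ∀ {L L′} → IsAVertex G L → IsAVertex G L′ → L ≢ L′ → AAdj G L L′ ⇔ Touching L L′
  AAdj⇔Touching vL vL′ L≢L′ = mk⇔ (to conn⇔ ∘ proj₂) ((L≢L′ ,_) ∘ from conn⇔)
    where conn⇔ : InducedConnected G (_ ∪ _) ⇔ Touching _ _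
          conn⇔ = ∪-connected⇔Touching (AVertex-connected vL) (AVertex-connected vL′)
                                        (AVertex-nonempty vL) (AVertex-nonempty vL′)

  ⁅⁆-injective : ∀ {a b : V} → ⁅ a ⁆ ≡ ⁅ b ⁆ → a ≡ b
  ⁅⁆-injective {a} {b} eq = x∈⁅y⁆⇒x≡y b (subst (a ∈_) eq (x∈⁅x⁆ a))

  AAdj-⁅⁆ : ∀ {a b} → AAdj G ⁅ a ⁆ ⁅ b ⁆ ⇔ Adj G a b
  AAdj-⁅⁆ {a} {b} with a Fin.≟ b
  ... | yes refl = mk⇔ (λ { (≢ , _) → ⊥-elim (≢ refl) }) (⊥-elim ∘ Adj-irrefl)
  ... | no a≢b   =
    mk⇔ (adjacent ∘ to touching⇔) (from touching⇔ ∘ λ ab → a , b , x∈⁅x⁆ a , x∈⁅x⁆ b , inj₂ ab)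
    where
    touching⇔ : AAdj G ⁅ a ⁆ ⁅ b ⁆ ⇔ Touching ⁅ a ⁆ ⁅ b ⁆
    touching⇔ = AAdj⇔Touching (inj₁ (a , refl)) (inj₁ (b , refl)) (a≢b ∘ ⁅⁆-injective)
    adjacent : Touching ⁅ a ⁆ ⁅ b ⁆ → Adj G a b
    adjacent (u , v , u∈ , v∈ , uv) with x∈⁅y⁆⇒x≡y a u∈ | x∈⁅y⁆⇒x≡y b v∈
    ... | refl | refl = [ ⊥-elim ∘ a≢b , id ] uv

  hole⇒AHole : HasHole (λ _ → ⊤) (Adj G) → HasHole (IsAVertex G) (AAdj G)
  hole⇒AHole (k , c , 4≤k , _ , c-injective , c-adj) =
    k , ⁅_⁆ ∘ c , 4≤k , (λ i → inj₁ (c i , refl)) , (λ i j → c-injective i j ∘ ⁅⁆-injective) ,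
    λ i j → c-adj i j ⇔-∘ AAdj-⁅⁆

  record Walk : Set where
    constructor walk
    field
      start  : V
      rest   : List V
      linked : Linked (Adj G) (start ∷ rest)

    vertices : List V
    vertices = start ∷ rest

  open Walk

  -- u ∷ along r vs lists the walk r from u to v, followed by vs
  along : ∀ {S u v} → Reach G S u v → List V → List V
  along (here _)             vs = vs
  along (step {w = w} _ _ r) vs = w ∷ along r vs

  along-linked : ∀ {S u v vs} (r : Reach G S u v) → Linked (Adj G) (v ∷ vs) → Linked (Adj G) (u ∷ along r vs)
  along-linked (here _)     l = l
  along-linked (step _ a r) l = a ∷ along-linked r l

  along-⊆ : ∀ {S u v vs} (r : Reach G S u v) → (∀ {z} → z ∈ₗ v ∷ vs → z ∈ S) →
            ∀ {z} → z ∈ₗ u ∷ along r vs → z ∈ S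
  along-⊆ (here _)       ⊆S z∈          = ⊆S z∈
  along-⊆ (step u∈S _ _) ⊆S (here refl) = u∈S
  along-⊆ (step _ _ r)   ⊆S (there z∈)  = along-⊆ r ⊆S z∈

  along-⊇ : ∀ {S u v vs} (r : Reach G S u v) → ∀ {z} → z ∈ₗ v ∷ vs → z ∈ₗ u ∷ along r vs
  along-⊇ (here _)     z∈ = z∈
  along-⊇ (step _ _ r) z∈ = there (along-⊇ r z∈)

  -- Each target in L is visited by a detour u → t → u.
  covering : ∀ {L u} → InducedConnected G L → u ∈ L → (ts : List V) →
             Σ (List V) λ vs → Linked (Adj G) (u ∷ vs) × (∀ {z} → z ∈ₗ u ∷ vs → z ∈ L) ×
                               (∀ {t} → t ∈ₗ ts → t ∈ L → t ∈ₗ u ∷ vs)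
  covering conn u∈L [] = [] , [-] , (λ { (here refl) → u∈L }) , λ ()
  covering {L} {u} conn u∈L (t ∷ ts) with covering conn u∈L ts | t ∈? L
  ... | vs , l , ⊆L , ⊇ts | no t∉L =
    vs , l , ⊆L , λ { (here refl) t∈L → ⊥-elim (t∉L t∈L) ; (there t∈) → ⊇ts t∈ }
  ... | vs , l , ⊆L , ⊇ts | yes t∈L =
    along go (along back vs) , along-linked go (along-linked back l) , along-⊆ go (along-⊆ back ⊆L) ,
    λ { (here refl) _    → along-⊇ go (here refl)
      ; (there t′∈) t′∈L → along-⊇ go (along-⊇ back (⊇ts t′∈ t′∈L)) }
    where
    go : Reach G L u t
    go = conn u t u∈L t∈L
    back : Reach G L t u
    back = conn t u t∈L u∈L

  coverWalk : ∀ {L} → IsAVertex G L → Σ Walk λ w → ∀ {v} → v ∈ₗ vertices w ⇔ v ∈ L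
  coverWalk vL with AVertex-nonempty vL
  ... | u , u∈L with covering (AVertex-connected vL) u∈L (allFin n)
  ...   | vs , l , ⊆L , ⊇all = walk u vs l , mk⇔ ⊆L (⊇all (∈-allFin _))

  Touch : List V → List V → Set
  Touch us vs = Any (λ u → Any (Close u) vs) us

  Touch? : ∀ us vs → Dec (Touch us vs)
  Touch? us vs = Any.any? (λ u → Any.any? (Close? u) vs) us

  Touch-sym : ∀ {us vs} → Touch us vs → Touch vs us
  Touch-sym = Any.map (Any.map Close-sym) ∘ swap

  Touch⇔Touching : ∀ {us vs L L′} → (∀ {v} → v ∈ₗ us ⇔ v ∈ L) → (∀ {v} → v ∈ₗ vs ⇔ v ∈ L′) →
                   Touch us vs ⇔ Touching L L′
  Touch⇔Touching {us} {vs} {L} {L′} us⇔L vs⇔L′ = mk⇔ touching touch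
    where
    touching : Touch us vs → Touching L L′
    touching t with find t
    ... | u , u∈ , close with find close
    ...   | v , v∈ , uv = u , v , to us⇔L u∈ , to vs⇔L′ v∈ , uv
    touch : Touching L L′ → Touch us vs
    touch (u , v , u∈L , v∈L′ , uv) = lose (from us⇔L u∈L) (lose (from vs⇔L′ v∈L′) uv)

  -- Cycles of walks

  Touches : Walk → Walk → Set
  Touches a b = Touch (vertices a) (vertices b)

  Touches? : ∀ a b → Dec (Touches a b)
  Touches? a b = Touch? (vertices a) (vertices b)

  module ByTouch = Induced Touches Touch-sym
  module ByClose = Induced Close Close-sym
  open ByTouch using (cycle) renaming (Cycle to WalkCycle)
  open ByTouch.Cycle using (elements)

  AHole⇒walkCycle : HasHole (IsAVertex G) (AAdj G) → WalkCycle
  AHole⇒walkCycle (k , L , 4≤k , vL , L-injective , L-adj) = ByTouch.cycleOf {c = cover} 4≤k shaped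
    where
    cover : Fin k → Walk
    cover i = proj₁ (coverWalk (vL i))
    shaped : ByTouch.Shaped (CycNeighbor k) cover
    shaped i j i≢j = L-adj i j ⇔-∘ (⇔-sym (AAdj⇔Touching (vL i) (vL j) (i≢j ∘ L-injective i j))
                                   ⇔-∘ Touch⇔Touching (proj₂ (coverWalk (vL i))) (proj₂ (coverWalk (vL j))))

  ¬Close⇒≢ : ∀ {u v} → ¬ Close u v → u ≢ v
  ¬Close⇒≢ = _∘ inj₁

  pathHead∉ : ∀ {m y z} (ys : Vec V m) → ByClose.LinksOnlyHead y (ys ∷ʳ z) → ByClose.IsPath (ys ∷ʳ z) →
              All (y ≢_) ys
  pathHead∉ []       _           _          = []
  pathHead∉ (_ ∷ ys) (_ , ¬yys) (y′l , _) =
    y≢y′ (ys ∷ʳ _) y′l ¬yys ∷ All.map ¬Close⇒≢ (proj₁ (All-∷ʳ⁻ ys ¬yys))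
    where
    y≢y′ : ∀ {m y y′} (zs : Vec V (suc m)) → ByClose.LinksOnlyHead y′ zs → All (λ z → ¬ Close y z) zs →
           y ≢ y′
    y≢y′ (_ ∷ _) (y′z , _) (¬yz ∷ _) refl = ¬yz y′z

  -- Only the last vertex of a Close-path may repeat its predecessor.
  pathUnique : ∀ {m z} (ys : Vec V m) → ByClose.IsPath (ys ∷ʳ z) → Unique ys
  pathUnique []       _         = []
  pathUnique (y ∷ ys) (yl , yp) = pathHead∉ ys yl yp ∷ pathUnique ys yp

  cycleUnique : ∀ {m x p q} {mid : Vec V (suc m)} → ByClose.IsCycle x p mid q → Unique (x ∷ p ∷ (mid ∷ʳ q))
  cycleUnique {x = x} {p} {q} {m′ ∷ mid} c =
    (x≢p ∷ All-∷ʳ⁺ (All.map ¬Close⇒≢ noChord) x≢q)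
    ∷ All-∷ʳ⁺ (Unique.head (pathUnique (p ∷ m′ ∷ mid) path)) (¬Close⇒≢ ¬pq)
    ∷ pathUnique (m′ ∷ (mid ∷ʳ q))
        (ByClose.path-∷ʳ (m′ ∷ mid) (proj₂ path) (Close-sym linkLast) (All.map (_∘ Close-sym) noChord))
    where
    open ByClose.IsCycle c
    ¬pq : ¬ Close p q
    ¬pq = proj₂ (All-∷ʳ⁻ mid (proj₂ (proj₁ path)))
    x≢p : x ≢ p
    x≢p x≡p = ¬pq (subst (λ t → Close t q) x≡p linkLast)
    x≢q : x ≢ q
    x≢q x≡q = ¬pq (Close-sym (subst (λ t → Close t p) x≡q linkFirst))

  closeCycle⇒hole : ∀ {k} {c : Fin k → V} → 4 ≤ k → ByClose.Shaped (CycNeighbor k) c →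
                    HasHole (λ _ → ⊤) (Adj G)
  closeCycle⇒hole 4≤k sh = _ , lookup vs , s≤s (s≤s (s≤s (s≤s z≤n))) , (λ _ → tt) , injective , adjacency
    where
    C : ByClose.Cycle
    C = ByClose.cycleOf 4≤k sh
    vs : Vec V _
    vs = ByClose.Cycle.elements C
    injective : ∀ i j → lookup vs i ≡ lookup vs j → i ≡ j
    injective = lookup-injective (cycleUnique (ByClose.Cycle.isCycle C))
    adjacency : ∀ i j → Adj G (lookup vs i) (lookup vs j) ⇔ CycNeighbor _ i j
    adjacency i j with i Fin.≟ j
    ... | yes refl = mk⇔ (⊥-elim ∘ Adj-irrefl) (⊥-elim ∘ CycNeighbor-irrefl (s≤s (s≤s z≤n)))
    ... | no i≢j   = mk⇔ (to close⇔ ∘ inj₂) ([ ⊥-elim ∘ i≢j ∘ injective i j , id ] ∘ from close⇔)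
      where close⇔ : Close (lookup vs i) (lookup vs j) ⇔ CycNeighbor _ i j
            close⇔ = ByClose.Cycle.shaped C i j i≢j

  excess : Walk → ℕ
  excess = length ∘ rest

  Short Long : Walk → Set
  Short w = rest w ≡ []
  Long w = 0 < excess w

  touches-short : ∀ {a b} → Short a → Short b → Touches a b ⇔ Close (start a) (start b)
  touches-short {walk _ [] _} {walk _ [] _} refl refl =
    mk⇔ (λ { (here (here uv)) → uv ; (here (there ())) ; (there ()) }) (λ uv → here (here uv))

  shortCycle⇒hole : (C : WalkCycle) → All Short (elements C) → HasHole (λ _ → ⊤) (Adj G)
  shortCycle⇒hole C short = closeCycle⇒hole {c = start ∘ w} (s≤s (s≤s (s≤s (s≤s z≤n))))
    λ i j i≢j → ByTouch.Cycle.shaped C i j i≢j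
                ⇔-∘ ⇔-sym (touches-short {w i} {w j} (lookup⁺ short i) (lookup⁺ short j))
    where w : Fin _ → Walk
          w = lookup (elements C)

  cycleExcess : WalkCycle → ℕ
  cycleExcess = sum ∘ map excess ∘ elements

  cycleExcess-rotate : ∀ C → cycleExcess (ByTouch.rotateCycle C) ≡ cycleExcess C
  cycleExcess-rotate C = trans (cong (sum ∘ map excess) (ByTouch.elements-rotateCycle C))
                               (trans (sum-map-∷ʳ excess (Vec.tail (elements C)))
                                      (+-comm _ (excess (ByTouch.Cycle.x C))))

  LongAt : ∀ {k} → ℕ → Vec Walk k → Set
  LongAt _       []       = ⊥
  LongAt zero    (w ∷ _)  = Long w
  LongAt (suc d) (_ ∷ ws) = LongAt d ws

  LongAt-∷ʳ : ∀ {k w} d (ws : Vec Walk k) → LongAt d ws → LongAt d (ws ∷ʳ w)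
  LongAt-∷ʳ zero    (_ ∷ _)  long = long
  LongAt-∷ʳ (suc d) (_ ∷ ws) long = LongAt-∷ʳ d ws long

  findLong : ∀ {k} (ws : Vec Walk k) → All Short ws ⊎ ∃ λ d → LongAt d ws
  findLong []                      = inj₁ []
  findLong (walk _ []      _ ∷ ws) = Sum.map (refl ∷_) (Product.map suc id) (findLong ws)
  findLong (walk _ (_ ∷ _) _ ∷ ws) = inj₂ (0 , s≤s z≤n)

  toFront : ∀ d (C : WalkCycle) → LongAt d (elements C) →
            Σ WalkCycle λ C′ → cycleExcess C′ ≡ cycleExcess C × Long (ByTouch.Cycle.x C′)
  toFront zero    C long = C , refl , long
  toFront (suc d) C long
    with toFront d (ByTouch.rotateCycle C)
                   (subst (LongAt d) (sym (ByTouch.elements-rotateCycle C)) (LongAt-∷ʳ d (Vec.tail (elements C)) long))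
  ... | C′ , same , long′ = C′ , trans same (cycleExcess-rotate C) , long′

  single : V → Walk
  single v = walk v [] [-]

  behead : ∀ {w y ys} → Linked (Adj G) (w ∷ y ∷ ys) → Walk
  behead {y = y} {ys} l = walk y ys (Linked.tail l)

  reduceFront : (C : WalkCycle) → Long (ByTouch.Cycle.x C) → Σ WalkCycle λ C′ → cycleExcess C′ < cycleExcess C
  reduceFront (cycle (walk w (y ∷ ys) l) p mid q c) _
    with ByTouch.separate {a = single w} {b = behead l} Touches? c
           (λ { (here t) → here t ; (there ()) }) there (here (here (inj₂ (Linked.head l))))
           (λ { (here t) → inj₁ (here t) ; (there t) → inj₂ t })
  ... | inj₁ c′               = cycle (single w) p mid q c′ , s≤s (m≤n+m _ (length ys))
  ... | inj₂ (inj₁ c′)        = cycle (behead l) p mid q c′ , ≤-refl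
  ... | inj₂ (inj₂ (inj₁ c′)) = cycle (single w) (behead l) (p ∷ mid) q c′ , ≤-refl
  ... | inj₂ (inj₂ (inj₂ c′)) = cycle (behead l) (single w) (p ∷ mid) q c′ , ≤-refl

  walkCycle⇒hole : (C : WalkCycle) → Acc _<_ (cycleExcess C) → HasHole (λ _ → ⊤) (Adj G)
  walkCycle⇒hole C (acc smaller) with findLong (elements C)
  ... | inj₁ short = shortCycle⇒hole C short
  ... | inj₂ (d , long) with toFront d C long
  ...   | C′ , same , longFront with reduceFront C′ longFront
  ...     | C″ , fewer = walkCycle⇒hole C″ (smaller (subst (cycleExcess C″ <_) same fewer))

  AHole⇒hole : HasHole (IsAVertex G) (AAdj G) → HasHole (λ _ → ⊤) (Adj G)
  AHole⇒hole aHole = walkCycle⇒hole C (<-wellFounded (cycleExcess C))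
    where C : WalkCycle
          C = AHole⇒walkCycle aHole

mainTheorem2 : ∀ {n : ℕ} (G : Graph n) → Connected G → (Chordal G ⇔ AChordal G)
mainTheorem2 G _ = mk⇔ (_∘ AHole⇒hole G) (_∘ hole⇒AHole G)
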